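{- Let $F$ be a simple graph with $|V(F)|=7$ such that its complement $\overline{F}$ contains a cycle $C_4$ as a subgraph. Then $F \nrightarrow (P_3, C_7)$.
   Context: All graphs are finite and simple. $P_3$ is the path on $3$ vertices and $C_n$ is the cycle on $n$ vertices. For graphs $F,G,H$, we write $F \rightarrow (G,H)$ if for every $2$-coloring of the edges of $F$ with colors red and blue there is a red copy of $G$ (a subgraph of $F$ isomorphic to $G$ with all edges red) or a blue copy of $H$; $F \nrightarrow (G,H)$ means this fails, i.e. some red/blue edge-coloring of $F$ contains neither a red $G$ nor a blue $H$. -}

module Defs where

open import Data.Nat using (ℕ; suc)
open import Data.Fin using (Fin; toℕ; zero; suc; _≟_)
open import Data.Bool using (Bool; true; false; not; _∧_; _∨_)
open import Data.Bool.Properties using (∧-comm; ∨-comm; ∧-zeroʳ)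
import Data.Nat as ℕ
open import Data.Product using (Σ; _×_; _,_)
open import Relation.Binary.PropositionalEquality using (_≡_; refl; cong; cong₂; sym)
open import Relation.Nullary using (¬_; yes; no)
open import Relation.Nullary.Decidable using (⌊_⌋)
open import Function.Definitions using (Injective)

record Graph (n : ℕ) : Set where
  field
    adj    : Fin n → Fin n → Bool
    adj-sym    : ∀ u v → adj u v ≡ adj v u
    adj-irrefl : ∀ v → adj v v ≡ false
open Graph public

private
  ≟-sym : ∀ {n} (u v : Fin n) → ⌊ u ≟ v ⌋ ≡ ⌊ v ≟ u ⌋
  ≟-sym u v with u ≟ v | v ≟ u
  ... | yes _ | yes _ = refl
  ... | no _  | no _  = refl
  ... | yes p | no q  = Data.Empty.⊥-elim (q (sym p))
    where import Data.Empty
  ... | no p  | yes q = Data.Empty.⊥-elim (p (sym q))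
    where import Data.Empty

  ≟-refl : ∀ {n} (v : Fin n) → ⌊ v ≟ v ⌋ ≡ true
  ≟-refl v with v ≟ v
  ... | yes _ = refl
  ... | no p  = Data.Empty.⊥-elim (p refl)
    where import Data.Empty

complement : ∀ {n} → Graph n → Graph n
complement G = record
  { adj        = λ u v → not (adj G u v) ∧ not ⌊ u ≟ v ⌋
  ; adj-sym    = λ u v → cong₂ (λ a b → not a ∧ not b) (adj-sym G u v) (≟-sym u v)
  ; adj-irrefl = helper }
  where
    helper : ∀ v → (not (adj G v v) ∧ not ⌊ v ≟ v ⌋) ≡ false
    helper v rewrite ≟-refl v = ∧-zeroʳ (not (adj G v v))

_⊆_ : ∀ {m n} → Graph m → Graph n → Set
_⊆_ {m} {n} H G = Σ (Fin m → Fin n) λ f →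
  Injective _≡_ _≡_ f × (∀ u v → adj H u v ≡ true → adj G (f u) (f v) ≡ true)

-- Red/blue edge colourings of G: a symmetric colour assignment to pairs
-- (only the values on edges of G matter).
data Colour : Set where
  red blue : Colour

record Colouring {n} (G : Graph n) : Set where
  field
    col     : Fin n → Fin n → Colour
    col-sym : ∀ u v → col u v ≡ col v u
open Colouring public

colourEq : Colour → Colour → Bool
colourEq red  red  = true
colourEq blue blue = true
colourEq _    _    = false

colourClass : ∀ {n} {G : Graph n} → Colouring G → Colour → Graph n
colourClass {G = G} χ c = record
  { adj        = λ u v → adj G u v ∧ isC (col χ u v)
  ; adj-sym    = λ u v → cong₂ (λ a b → a ∧ isC b) (adj-sym G u v) (col-sym χ u v)
  ; adj-irrefl = λ v → helper v }
  where
    isC : Colour → Bool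
    isC d = colourEq d c
    helper : ∀ v → (adj G v v ∧ isC (col χ v v)) ≡ false
    helper v rewrite adj-irrefl G v = refl

_⟶⟨_,_⟩ : ∀ {n a b} → Graph n → Graph a → Graph b → Set
F ⟶⟨ G , H ⟩ = (χ : Colouring F) → (G ⊆ colourClass χ red) Data.Sum.⊎ (H ⊆ colourClass χ blue)
  where import Data.Sum

fromRel : ∀ {n} → (Fin n → Fin n → Bool) → Graph n
fromRel r = record
  { adj        = λ u v → (r u v ∨ r v u) ∧ not ⌊ u ≟ v ⌋
  ; adj-sym    = λ u v → cong₂ (λ a b → a ∧ not b) (∨-comm (r u v) (r v u)) (≟-sym u v)
  ; adj-irrefl = helper }
  where
    helper : ∀ v → ((r v v ∨ r v v) ∧ not ⌊ v ≟ v ⌋) ≡ false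
    helper v rewrite ≟-refl v = ∧-zeroʳ (r v v ∨ r v v)

Path : (n : ℕ) → Graph n
Path n = fromRel (λ i j → ⌊ suc (toℕ i) ℕ.≟ toℕ j ⌋)

-- Cycle C_n on vertices 0,…,n-1 : i ~ j iff j ≡ i + 1 (mod n), i.e. j = i + 1,
-- or i = n - 1 and j = 0.  (Used only for n ≥ 3, where this is the n-cycle.)
Cycle : (n : ℕ) → Graph n
Cycle n = fromRel (λ i j → ⌊ suc (toℕ i) ℕ.≟ toℕ j ⌋
                            ∨ (⌊ suc (toℕ i) ℕ.≟ n ⌋ ∧ ⌊ toℕ j ℕ.≟ 0 ⌋))

-- Let the complement of F contain the 4-cycle a₀a₁a₂a₃. Colour the two diagonals
-- a₀a₂ and a₁a₃ red (whether or not they are edges of F) and everything else blue.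
-- The red edges form a matching, so there is no red P₃. No blue edge joins two of
-- the aᵢ: the sides of the 4-cycle are not edges of F and the diagonals are red.
-- A blue C₇ would be a Hamiltonian cycle of F, in which {a₀,…,a₃} would be an
-- independent 4-set; but C₇ has independence number 3.
module Submission where

open import Defs

open import Data.Nat using (ℕ; zero; suc)
import Data.Nat.Properties as ℕ
open import Data.Fin using (Fin; zero; suc; _≟_; punchOut)
open import Data.Fin.Properties using (all?; any?; injective⇒≤; punchOut-injective)
open import Data.Bool using (true; false; _∧_; if_then_else_)
open import Data.Bool.Properties using (¬-not; ∧-zeroʳ; not-injective)
import Data.Bool as Bool
open import Data.Product using (∃; _×_; _,_; proj₁; proj₂)
open import Data.Sum using (_⊎_; inj₁; inj₂; [_,_])
open import Function using (_∘_)
open import Function.Definitions using (Injective; StrictlySurjective)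
open import Relation.Binary.PropositionalEquality
  using (_≡_; _≢_; _≗_; refl; sym; trans; cong; subst₂)
open import Relation.Nullary using (¬_; Dec; yes; no; contradiction; ¬?; _×-dec_; _→-dec_; _⊎-dec_)
open import Relation.Nullary.Decidable using (⌊_⌋; from-yes; map′)
open import Data.Vec.Functional using ([]; _∷_)

private
  variable
    k n : ℕ

injective⇒strictlySurjective : {h : Fin n → Fin n} →
  Injective _≡_ _≡_ h → StrictlySurjective _≡_ h
injective⇒strictlySurjective {suc n} {h} h-inj y with any? (λ x → h x ≟ y)
... | yes hit = hit
... | no miss = contradiction (injective⇒≤ punched-injective) ℕ.1+n≰n
  where
  missed : ∀ x → y ≢ h x
  missed x y≡hx = miss (x , sym y≡hx)

  punched-injective : Injective _≡_ _≡_ (λ x → punchOut (missed x))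
  punched-injective = h-inj ∘ punchOut-injective (missed _) (missed _)

∧-true⇒ˡ : ∀ {a b} → a ∧ b ≡ true → a ≡ true
∧-true⇒ˡ {true} _ = refl

∧-true⇒ʳ : ∀ {a b} → a ∧ b ≡ true → b ≡ true
∧-true⇒ʳ {true} e = e

true≢false : true ≢ false
true≢false ()

Extensional : ((Fin k → Fin n) → Set) → Set
Extensional P = ∀ {s t} → s ≗ t → P s → P t

∀-functions? : {P : (Fin k → Fin n) → Set} →
  Extensional P → (∀ s → Dec (P s)) → Dec (∀ s → P s)
∀-functions? {zero} ext P? = map′ (λ p s → ext (λ ()) p) (λ all → all []) (P? [])
∀-functions? {suc k} ext P? =
  map′ (λ all s → ext (cons-view s) (all (s zero) (s ∘ suc)))
       (λ all a t → all (a ∷ t))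
       (all? λ a → ∀-functions? (ext ∘ cons-cong a) (P? ∘ (a ∷_)))
  where
  cons-view : ∀ s → (s zero ∷ s ∘ suc) ≗ s
  cons-view s zero    = refl
  cons-view s (suc i) = refl

  cons-cong : ∀ a {s t} → s ≗ t → (a ∷ s) ≗ (a ∷ t)
  cons-cong a s≗t zero    = refl
  cons-cong a s≗t (suc i) = s≗t i

Independent : Graph n → (Fin k → Fin n) → Set
Independent G s = Injective _≡_ _≡_ s × (∀ i j → adj G (s i) (s j) ≡ false)

independent? : (G : Graph n) (s : Fin k → Fin n) → Dec (Independent G s)
independent? G s =
  map′ (λ inj {i} {j} → inj i j) (λ inj i j → inj {i} {j})
       (all? λ i → all? λ j → s i ≟ s j →-dec i ≟ j)
  ×-dec all? (λ i → all? λ j → adj G (s i) (s j) Bool.≟ false)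

Independent-resp-≗ : {G : Graph n} {s t : Fin k → Fin n} →
  s ≗ t → Independent G s → Independent G t
Independent-resp-≗ {G = G} s≗t (s-inj , s-indep) =
    (λ {i} {j} tᵢ≡tⱼ → s-inj (trans (s≗t i) (trans tᵢ≡tⱼ (sym (s≗t j)))))
  , (λ i j → subst₂ (λ u v → adj G u v ≡ false) (s≗t i) (s≗t j) (s-indep i j))

cycle₇-no-independent-4-set : (s : Fin 4 → Fin 7) → ¬ Independent (Cycle 7) s
cycle₇-no-independent-4-set = from-yes
  (∀-functions? {k = 4} {n = 7}
     (λ s≗t ¬Is It → ¬Is (Independent-resp-≗ {G = Cycle 7} (sym ∘ s≗t) It))
     (¬? ∘ independent? (Cycle 7)))

spanning-⊆-reflects-independent : {H G : Graph n} {s : Fin k → Fin n} →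
  H ⊆ G → Independent G s → ∃ (Independent H)
spanning-⊆-reflects-independent {H = H} {G} {s} (h , h-inj , h-edges) (s-inj , s-indep) =
  preimage ∘ s , preimage∘s-injective , preimage∘s-independent
  where
  preimage : Fin _ → Fin _
  preimage y = proj₁ (injective⇒strictlySurjective h-inj y)

  h∘preimage : ∀ y → h (preimage y) ≡ y
  h∘preimage y = proj₂ (injective⇒strictlySurjective h-inj y)

  preimage∘s-injective : Injective _≡_ _≡_ (preimage ∘ s)
  preimage∘s-injective {i} {j} eq =
    s-inj (trans (sym (h∘preimage (s i))) (trans (cong h eq) (h∘preimage (s j))))

  edge-pushforward : ∀ {i j} → adj H (preimage (s i)) (preimage (s j)) ≡ true →
                     adj G (s i) (s j) ≡ true
  edge-pushforward edge =
    subst₂ (λ u v → adj G u v ≡ true) (h∘preimage _) (h∘preimage _) (h-edges _ _ edge)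

  preimage∘s-independent : ∀ i j → adj H (preimage (s i)) (preimage (s j)) ≡ false
  preimage∘s-independent i j =
    ¬-not λ edge → true≢false (trans (sym (edge-pushforward edge)) (s-indep i j))

colourClass-non-edge : {G : Graph n} (χ : Colouring G) (c : Colour) →
  ∀ {u v} → adj G u v ≡ false → adj (colourClass χ c) u v ≡ false
colourClass-non-edge χ c {u} {v} non-edge = cong (_∧ colourEq (col χ u v) c) non-edge

Matching : Graph n → Set
Matching G = ∀ {u v w} → adj G u v ≡ true → adj G w v ≡ true → u ≡ w

matching⇒¬Path₃⊆ : {G : Graph n} → Matching G → ¬ (Path 3 ⊆ G)
matching⇒¬Path₃⊆ G-matching (g , g-inj , g-edges) =
  0≢2 (g-inj (G-matching (g-edges zero (suc zero) refl)
                         (g-edges (suc (suc zero)) (suc zero) refl)))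
  where
  0≢2 : zero ≢ suc (suc zero)
  0≢2 ()

module ColourBy {G : Graph n} {R : Fin n → Fin n → Set} (R? : ∀ u v → Dec (R u v))
         (R-sym : ∀ {u v} → R u v → R v u) where

  colourBy : Colouring G
  colourBy = record
    { col     = λ u v → if ⌊ R? u v ⌋ then red else blue
    ; col-sym = λ u v → cong (if_then red else blue) (⌊R?⌋-sym u v)
    }
    where
    ⌊R?⌋-sym : ∀ u v → ⌊ R? u v ⌋ ≡ ⌊ R? v u ⌋
    ⌊R?⌋-sym u v with R? u v | R? v u
    ... | yes _   | yes _   = refl
    ... | no _    | no _    = refl
    ... | yes ruv | no ¬rvu = contradiction (R-sym ruv) ¬rvu
    ... | no ¬ruv | yes rvu = contradiction (R-sym rvu) ¬ruv

  red⇒R : ∀ {u v} → adj (colourClass colourBy red) u v ≡ true → R u v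
  red⇒R {u} {v} red-edge with R? u v
  ... | yes ruv = ruv
  ... | no _    = contradiction (∧-true⇒ʳ {adj G u v} red-edge) λ ()

  R⇒¬blue : ∀ {u v} → R u v → adj (colourClass colourBy blue) u v ≡ false
  R⇒¬blue {u} {v} ruv with R? u v
  ... | yes _   = ∧-zeroʳ (adj G u v)
  ... | no ¬ruv = contradiction ruv ¬ruv

Matched : (σ : Fin k → Fin k) (f : Fin k → Fin n) → Fin n → Fin n → Set
Matched σ f u v = ∃ λ j → u ≡ f (σ j) × v ≡ f j

matched? : (σ : Fin k → Fin k) (f : Fin k → Fin n) → ∀ u v → Dec (Matched σ f u v)
matched? σ f u v = any? λ j → (u ≟ f (σ j)) ×-dec (v ≟ f j)

matched-sym : {σ : Fin k → Fin k} {f : Fin k → Fin n} → (∀ i → σ (σ i) ≡ i) →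
  ∀ {u v} → Matched σ f u v → Matched σ f v u
matched-sym {σ = σ} {f} σ-involutive (j , u≡fσj , v≡fj) =
  σ j , trans v≡fj (cong f (sym (σ-involutive j))) , u≡fσj

matched-unique : {σ : Fin k → Fin k} {f : Fin k → Fin n} → Injective _≡_ _≡_ f →
  ∀ {u v w} → Matched σ f u v → Matched σ f w v → u ≡ w
matched-unique {σ = σ} {f} f-inj (j , refl , v≡fj) (j′ , refl , v≡fj′) =
  cong (f ∘ σ) (f-inj (trans (sym v≡fj) v≡fj′))

opposite : Fin 4 → Fin 4
opposite zero                   = suc (suc zero)
opposite (suc zero)             = suc (suc (suc zero))
opposite (suc (suc zero))       = zero
opposite (suc (suc (suc zero))) = suc zero

opposite-involutive : ∀ i → opposite (opposite i) ≡ i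
opposite-involutive zero                   = refl
opposite-involutive (suc zero)             = refl
opposite-involutive (suc (suc zero))       = refl
opposite-involutive (suc (suc (suc zero))) = refl

cycle₄-equal⊎adjacent⊎opposite : ∀ i j → i ≡ j ⊎ adj (Cycle 4) i j ≡ true ⊎ j ≡ opposite i
cycle₄-equal⊎adjacent⊎opposite = from-yes
  (all? λ i → all? λ j → i ≟ j ⊎-dec adj (Cycle 4) i j Bool.≟ true ⊎-dec j ≟ opposite i)

lemma4 : (F : Graph 7) → Cycle 4 ⊆ complement F → ¬ (F ⟶⟨ Path 3 , Cycle 7 ⟩)
lemma4 F (f , f-inj , f-sides) arrow = [ no-red-P₃ , no-blue-C₇ ] (arrow χ)
  where
  open ColourBy {G = F} (matched? opposite f) (matched-sym opposite-involutive)

  χ : Colouring F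
  χ = colourBy

  no-red-P₃ : ¬ (Path 3 ⊆ colourClass χ red)
  no-red-P₃ = matching⇒¬Path₃⊆ {G = colourClass χ red}
    λ uv wv → matched-unique f-inj (red⇒R uv) (red⇒R wv)

  side⇒¬F : ∀ {i j} → adj (Cycle 4) i j ≡ true → adj F (f i) (f j) ≡ false
  side⇒¬F side = not-injective (∧-true⇒ˡ (f-sides _ _ side))

  C₄-blue-independent : Independent (colourClass χ blue) f
  C₄-blue-independent = f-inj , blue-free
    where
    blue-free : ∀ i j → adj (colourClass χ blue) (f i) (f j) ≡ false
    blue-free i j with cycle₄-equal⊎adjacent⊎opposite i j
    ... | inj₁ refl        = adj-irrefl (colourClass χ blue) (f i)
    ... | inj₂ (inj₁ side) = colourClass-non-edge χ blue (side⇒¬F side)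
    ... | inj₂ (inj₂ refl) =
      R⇒¬blue (opposite i , cong f (sym (opposite-involutive i)) , refl)

  no-blue-C₇ : ¬ (Cycle 7 ⊆ colourClass χ blue)
  no-blue-C₇ C₇⊆blue =
    let s , s-independent = spanning-⊆-reflects-independent
                              {H = Cycle 7} {G = colourClass χ blue} C₇⊆blue C₄-blue-independent
    in  cycle₇-no-independent-4-set s s-independent
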